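{- Let $G$ be a finite simple graph with $\nu(G)=0$ such that for every edge $e$ of $G$, $\nu(G-e)>\nu(G)$. Then every always activated vertex of $G$ has even degree and every never activated vertex of $G$ has odd degree.
   Context: Let $G$ have vertex set $V=\{v_1,\dots,v_n\}$ and closed neighborhood matrix $N=N(G)$ over $\mathbb{Z}_2$ (entry $(i,j)$ is $1$ iff $i=j$ or $v_iv_j$ is an edge). The nullity is $\nu(G)=\dim\ker N$. Subsets $A\subseteq V$ are identified with characteristic vectors $\mathbf{x}_A\in\mathbb{Z}_2^n$; $\mathbf{x}\cdot\mathbf{y}=\mathbf{x}^t\mathbf{y}$ over $\mathbb{Z}_2$; $\mathbf{1}$ is the all-ones vector. A pattern $\mathbf{p}$ solves a configuration $\mathbf{c}$ if $N\mathbf{p}=\mathbf{c}$; $\mathbf{c}$ (or a set $A$ with $\mathbf{c}=\mathbf{x}_A$) is solvable if some pattern solves it. An odd dominating pattern is a solution of $N\mathbf{s}=\mathbf{1}$ (one always exists). A vertex $v$ is always activated if $\{v\}$ is solvable and $\mathbf{x}_{\{v\}}\cdot\mathbf{s}=1$ for every odd dominating pattern $\mathbf{s}$; never activated if $\{v\}$ is solvable and $\mathbf{x}_{\{v\}}\cdot\mathbf{s}=0$ for every odd dominating pattern $\mathbf{s}$. $G-e$ is $G$ with edge $e$ removed. -}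

module Defs where

open import Data.Nat using (ℕ; zero; suc; _+_; _*_; _%_; _<_)
open import Data.Nat.Logarithm using (⌊log₂_⌋)
open import Data.Bool using (Bool; true; false; _∧_; _∨_; _xor_; not; if_then_else_)
open import Data.Fin using (Fin; zero; suc; _≟_)
open import Data.List using (List; []; _∷_; map; _++_; length; filter)
open import Data.Product using (Σ; ∃; _×_; _,_)
open import Relation.Nullary.Decidable using (⌊_⌋)
open import Relation.Binary.PropositionalEquality using (_≡_)

-- Z₂ is modelled by Bool (xor = addition, ∧ = multiplication).
-- Vectors in Z₂^n are functions Fin n → Bool; n×n matrices are Fin n → Fin n → Bool.
Vec₂ : ℕ → Set
Vec₂ n = Fin n → Bool

Mat₂ : ℕ → Set
Mat₂ n = Fin n → Fin n → Bool

Σ₂ : ∀ {n} → Vec₂ n → Bool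
Σ₂ {zero}  f = false
Σ₂ {suc n} f = f zero xor Σ₂ (λ i → f (suc i))

count : ∀ {n} → Vec₂ n → ℕ
count {zero}  f = 0
count {suc n} f = (if f zero then 1 else 0) + count (λ i → f (suc i))

_·ᵥ_ : ∀ {n} → Mat₂ n → Vec₂ n → Vec₂ n
(M ·ᵥ x) i = Σ₂ (λ j → M i j ∧ x j)

_•_ : ∀ {n} → Vec₂ n → Vec₂ n → Bool
x • y = Σ₂ (λ i → x i ∧ y i)

zeroV : ∀ {n} → Vec₂ n
zeroV _ = false

oneV : ∀ {n} → Vec₂ n
oneV _ = true

unitV : ∀ {n} → Fin n → Vec₂ n
unitV v i = ⌊ v ≟ i ⌋

_≐_ : ∀ {n} → Vec₂ n → Vec₂ n → Set
x ≐ y = ∀ i → x i ≡ y i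

allVecs : (n : ℕ) → List (Vec₂ n)
allVecs zero    = (λ ()) ∷ []
allVecs (suc n) = map (cons false) (allVecs n) ++ map (cons true) (allVecs n)
  where
  cons : Bool → Vec₂ n → Vec₂ (suc n)
  cons b x zero    = b
  cons b x (suc i) = x i

isZero : ∀ {n} → Vec₂ n → Bool
isZero x = not (Σ₂-or x)
  where
  Σ₂-or : ∀ {m} → Vec₂ m → Bool
  Σ₂-or {zero}  f = false
  Σ₂-or {suc m} f = f zero ∨ Σ₂-or (λ i → f (suc i))

kerSize : ∀ {n} → Mat₂ n → ℕ
kerSize {n} M = length (filter (λ x → Data.Bool.T? (isZero (M ·ᵥ x))) (allVecs n))
  where import Data.Bool

-- dimension of ker M over Z₂: |ker M| = 2^dim, so dim = log₂ |ker M|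
dimKer : ∀ {n} → Mat₂ n → ℕ
dimKer M = ⌊log₂ kerSize M ⌋

record Graph (n : ℕ) : Set where
  field
    adj    : Fin n → Fin n → Bool
    sym    : ∀ i j → adj i j ≡ adj j i
    irrefl : ∀ i → adj i i ≡ false
open Graph public

N : ∀ {n} → Graph n → Mat₂ n
N G i j = ⌊ i ≟ j ⌋ ∨ adj G i j

ν : ∀ {n} → Graph n → ℕ
ν G = dimKer (N G)

degree : ∀ {n} → Graph n → Fin n → ℕ
degree G v = count (adj G v)

-- an edge of G: an (ordered representative of an) unordered pair {i,j} with i~j
Edge : ∀ {n} → Graph n → Set
Edge {n} G = Σ (Fin n) λ i → Σ (Fin n) λ j → adj G i j ≡ true

removeEdge : ∀ {n} (G : Graph n) → Edge G → Graph n
removeEdge {n} G (a , b , _) = record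
  { adj    = adj′
  ; sym    = sym′
  ; irrefl = irrefl′ }
  where
  hit : Fin n → Fin n → Bool
  hit i j = (⌊ i ≟ a ⌋ ∧ ⌊ j ≟ b ⌋) ∨ (⌊ i ≟ b ⌋ ∧ ⌊ j ≟ a ⌋)
  adj′ : Fin n → Fin n → Bool
  adj′ i j = adj G i j ∧ not (hit i j)
  open import Data.Bool.Properties using (∨-comm)
  open import Relation.Binary.PropositionalEquality using (cong₂; cong)
  sym′ : ∀ i j → adj′ i j ≡ adj′ j i
  sym′ i j = cong₂ _∧_ (Graph.sym G i j)
               (cong not (Relation.Binary.PropositionalEquality.trans
                 (∨-comm (⌊ i ≟ a ⌋ ∧ ⌊ j ≟ b ⌋) (⌊ i ≟ b ⌋ ∧ ⌊ j ≟ a ⌋))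
                 (cong₂ _∨_ (Data.Bool.Properties.∧-comm (⌊ i ≟ b ⌋) (⌊ j ≟ a ⌋))
                            (Data.Bool.Properties.∧-comm (⌊ i ≟ a ⌋) (⌊ j ≟ b ⌋)))))
    where import Data.Bool.Properties
          import Relation.Binary.PropositionalEquality
  irrefl′ : ∀ i → adj′ i i ≡ false
  irrefl′ i rewrite Graph.irrefl G i = Relation.Binary.PropositionalEquality.refl
    where import Relation.Binary.PropositionalEquality

_-ₑ_ : ∀ {n} (G : Graph n) → Edge G → Graph n
G -ₑ e = removeEdge G e

Solvable : ∀ {n} → Graph n → Vec₂ n → Set
Solvable {n} G c = Σ (Vec₂ n) λ p → (N G ·ᵥ p) ≐ c

OddDominating : ∀ {n} → Graph n → Vec₂ n → Set
OddDominating G s = (N G ·ᵥ s) ≐ oneV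

AlwaysActivated : ∀ {n} → Graph n → Fin n → Set
AlwaysActivated {n} G v =
  Solvable G (unitV v) × (∀ (s : Vec₂ n) → OddDominating G s → (unitV v • s) ≡ true)

NeverActivated : ∀ {n} → Graph n → Fin n → Set
NeverActivated {n} G v =
  Solvable G (unitV v) × (∀ (s : Vec₂ n) → OddDominating G s → (unitV v • s) ≡ false)

-- Since ν(G) = 0, N = N(G) is invertible over Z₂. Let s = N⁻¹𝟏 be the odd dominating
-- pattern and c_u = N⁻¹e_u. As N is symmetric so is N⁻¹, and as xᵗNx = Σ x for a
-- symmetric 0/1 matrix with unit diagonal, c_u(u) = Σ c_u = 𝟏ᵗc_u = sᵗNc_u = s(u).
-- For an edge ab, N(G − ab) = N + e_a e_bᵗ + e_b e_aᵗ; a nonzero kernel vector x of it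
-- satisfies x = x_b c_a + x_a c_b, and evaluating at a and b yields a singular 2×2
-- system forcing c_a(b) = 1 + s(a)s(b). Row v of N c_v = e_v and of N s = 𝟏 then give
-- deg v ≡ 1 + s(v) (mod 2), while v is always (never) activated exactly when s(v) = 1 (0).

module Submission where

open import Defs hiding (sym)
open import Algebra.Bundles using (CommutativeRing)
open import Data.Bool as Bool using (Bool; true; false; _∧_; _∨_; _xor_; not; if_then_else_; T?)
open import Data.Bool.Properties
  using ( xor-∧-commutativeRing; ¬-not; not-¬; xor-same; xor-assoc; xor-identityʳ
        ; ∧-comm; ∧-assoc; ∧-idem; ∧-zeroʳ; ∧-identityʳ; ∧-distribˡ-xor; ∧-distribʳ-xor)
open import Data.Fin as Fin using (Fin; zero; suc; _≟_; punchOut; combine; funToFin; finToFun)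
open import Data.Fin.Properties
  using (suc-injective; any?; injective⇒≤; punchOut-injective; finToFun-funToFin)
  renaming (funToFin-finToFin to funToFin-finToFun)
open import Data.List as List using (List; []; _∷_; _++_; length; filter)
open import Data.List.Properties using (length-++; filter-++; length-filter)
open import Data.Nat using (ℕ; zero; suc; _+_; _%_; _^_; _≤_; _<_; z≤n; s≤s)
open import Data.Nat.DivMod using (%-distribˡ-+)
open import Data.Nat.Logarithm using (⌊log₂_⌋; ⌊log₂⌋-mono-≤; ⌊log₂[2^n]⌋≡n)
open import Data.Nat.Properties
  using (<-irrefl; 1+n≰n; +-comm; +-identityʳ; ≤-trans; ≤-reflexive; m≤m+n; +-mono-≤)
open import Data.Product using (∃; _,_; _×_; proj₁; proj₂)
open import Data.Sum using (_⊎_; inj₁; inj₂)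
open import Data.Vec.Functional using (tail; map; zipWith) renaming (_∷_ to _◂_)
open import Function using (_∘_; Injective)
open import Relation.Nullary using (yes; no; contradiction)
open import Relation.Nullary.Decidable using (⌊_⌋; isYes≗does; dec-true; dec-false)
open import Relation.Binary.PropositionalEquality

open CommutativeRing xor-∧-commutativeRing using (semiring; *-commutativeSemigroup)
open import Algebra.Properties.CommutativeSemigroup *-commutativeSemigroup using (x∙yz≈y∙xz)
open import Algebra.Properties.Semiring.Sum semiring
  using (sum; sum-cong-≗; sum-replicate-zero; ∑-distrib-+; ∑-comm; *-distribˡ-sum; *-distribʳ-sum)

xor-cancel-middle : ∀ a b c → (a xor b) xor (b xor c) ≡ a xor c
xor-cancel-middle a b c = begin
  (a xor b) xor (b xor c)  ≡⟨ xor-assoc a b (b xor c) ⟩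
  a xor (b xor (b xor c))  ≡⟨ cong (a xor_) (sym (xor-assoc b b c)) ⟩
  a xor ((b xor b) xor c)  ≡⟨ cong (λ z → a xor (z xor c)) (xor-same b) ⟩
  a xor c                  ∎
  where open ≡-Reasoning

xor≡false⇒≡ : ∀ {a b} → a xor b ≡ false → a ≡ b
xor≡false⇒≡ {false} refl = refl
xor≡false⇒≡ {true} {true} _ = refl

∨-disjoint : ∀ a b → a ∧ b ≡ false → a ∨ b ≡ a xor b
∨-disjoint false b     _ = refl
∨-disjoint true  false _ = refl

∨-∧-not : ∀ d a h → (h ≡ true → d ≡ false × a ≡ true) → d ∨ (a ∧ not h) ≡ (d ∨ a) xor h
∨-∧-not d a false _ = trans (cong (d ∨_) (∧-identityʳ a)) (sym (xor-identityʳ (d ∨ a)))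
∨-∧-not d a true  h with h refl
... | refl , refl = refl

-- (xa, xb) ≠ 0 lies in the kernel of [[1 + m, sa], [sb, 1 + m]], whose determinant is 1 + m + sa sb.
2×2-singular : ∀ {xa xb sa sb m} → xa ≡ (xb ∧ sa) xor (xa ∧ m) → xb ≡ (xb ∧ m) xor (xa ∧ sb) →
               xa ∨ xb ≡ true → m ≡ not (sa ∧ sb)
2×2-singular {false} {false}                           _    _    ()
2×2-singular {true}  {false} {sa = false}              refl refl _ = refl
2×2-singular {true}  {false} {sa = true}               refl refl _ = refl
2×2-singular {false} {true}  {sa = false} {m = true}   _    _    _ = refl
2×2-singular {false} {true}  {sa = false} {m = false}  _    ()   _
2×2-singular {false} {true}  {sa = true}               ()   _    _
2×2-singular {true}  {true}  {sa = false} {sb = false} refl _    _ = refl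
2×2-singular {true}  {true}  {sa = false} {sb = true}  refl ()   _
2×2-singular {true}  {true}  {sa = true}  {m = false}  _    refl _ = refl
2×2-singular {true}  {true}  {sa = true}  {m = true}   ()   _    _

≟-sym : ∀ {n} (i j : Fin n) → ⌊ i ≟ j ⌋ ≡ ⌊ j ≟ i ⌋
≟-sym i j with i ≟ j | j ≟ i
... | yes _    | yes _    = refl
... | no  _    | no  _    = refl
... | yes i≡j  | no  j≢i  = contradiction (sym i≡j) j≢i
... | no  i≢j  | yes j≡i  = contradiction (sym j≡i) i≢j

Σ₂≡sum : ∀ {n} (f : Vec₂ n) → Σ₂ f ≡ sum f
Σ₂≡sum {zero}  f = refl
Σ₂≡sum {suc n} f = cong (f zero xor_) (Σ₂≡sum (tail f))

Σ₂-cong : ∀ {n} {f g : Vec₂ n} → f ≐ g → Σ₂ f ≡ Σ₂ g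
Σ₂-cong {f = f} {g} f≐g =
  trans (Σ₂≡sum f) (trans (sum-cong-≗ {x = f} {g} f≐g) (sym (Σ₂≡sum g)))

Σ₂-zero : ∀ {n} → Σ₂ {n} zeroV ≡ false
Σ₂-zero {n} = trans (Σ₂≡sum {n} zeroV) (sum-replicate-zero n)

Σ₂-xor : ∀ {n} (f g : Vec₂ n) → Σ₂ (zipWith _xor_ f g) ≡ Σ₂ f xor Σ₂ g
Σ₂-xor f g = trans (Σ₂≡sum (zipWith _xor_ f g))
                   (trans (∑-distrib-+ f g) (sym (cong₂ _xor_ (Σ₂≡sum f) (Σ₂≡sum g))))

Σ₂-∧ˡ : ∀ {n} b (f : Vec₂ n) → Σ₂ (map (b ∧_) f) ≡ b ∧ Σ₂ f
Σ₂-∧ˡ b f = trans (Σ₂≡sum (map (b ∧_) f))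
                  (trans (sym (*-distribˡ-sum b f)) (cong (b ∧_) (sym (Σ₂≡sum f))))

Σ₂-∧ʳ : ∀ {n} b (f : Vec₂ n) → Σ₂ (map (_∧ b) f) ≡ Σ₂ f ∧ b
Σ₂-∧ʳ b f = trans (Σ₂≡sum (map (_∧ b) f))
                  (trans (sym (*-distribʳ-sum b f)) (cong (_∧ b) (sym (Σ₂≡sum f))))

Σ₂-comm : ∀ {m n} (f : Fin m → Fin n → Bool) →
          Σ₂ (λ i → Σ₂ (f i)) ≡ Σ₂ (λ j → Σ₂ (λ i → f i j))
Σ₂-comm f = trans (double f) (trans (∑-comm f) (sym (double (λ j i → f i j))))
  where
  double : ∀ {m n} (g : Fin m → Fin n → Bool) → Σ₂ (λ i → Σ₂ (g i)) ≡ sum (λ i → sum (g i))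
  double g = trans (Σ₂≡sum (λ i → Σ₂ (g i)))
                   (sum-cong-≗ {x = λ i → Σ₂ (g i)} (λ i → Σ₂≡sum (g i)))

Σ₂-symmetric-trace : ∀ {n} (f : Fin n → Fin n → Bool) → (∀ i j → f i j ≡ f j i) →
                     Σ₂ (λ i → Σ₂ (f i)) ≡ Σ₂ (λ i → f i i)
Σ₂-symmetric-trace {zero}  f f-sym = refl
Σ₂-symmetric-trace {suc n} f f-sym = begin
  (f zero zero xor row) xor Σ₂ (λ i → f (suc i) zero xor Σ₂ (f′ i))
    ≡⟨ cong ((f zero zero xor row) xor_) (Σ₂-xor (λ i → f (suc i) zero) (λ i → Σ₂ (f′ i))) ⟩
  (f zero zero xor row) xor (Σ₂ (λ i → f (suc i) zero) xor Σ₂ (λ i → Σ₂ (f′ i)))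
    ≡⟨ cong₂ (λ r t → (f zero zero xor row) xor (r xor t))
             (Σ₂-cong (λ i → f-sym (suc i) zero))
             (Σ₂-symmetric-trace f′ (λ i j → f-sym (suc i) (suc j))) ⟩
  (f zero zero xor row) xor (row xor Σ₂ (λ i → f′ i i))
    ≡⟨ xor-cancel-middle (f zero zero) row _ ⟩
  f zero zero xor Σ₂ (λ i → f′ i i) ∎
  where
  open ≡-Reasoning
  row = Σ₂ (tail (f zero))
  f′ : Fin n → Fin n → Bool
  f′ i j = f (suc i) (suc j)

Σ₂-single : ∀ {n} (f : Vec₂ n) u → (∀ j → u ≢ j → f j ≡ false) → Σ₂ f ≡ f u
Σ₂-single {suc n} f zero    off =
  trans (cong (f zero xor_) (trans (Σ₂-cong (λ j → off (suc j) λ ())) (Σ₂-zero {n})))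
        (xor-identityʳ (f zero))
Σ₂-single         f (suc u) off =
  trans (cong (_xor Σ₂ (tail f)) (off zero λ ()))
        (Σ₂-single (tail f) u (λ j u≢j → off (suc j) (u≢j ∘ suc-injective)))

bit : Bool → ℕ
bit b = if b then 1 else 0

count-parity : ∀ {n} (f : Vec₂ n) → count f % 2 ≡ bit (Σ₂ f)
count-parity {zero}  f = refl
count-parity {suc n} f = begin
  (bit (f zero) + count (tail f)) % 2
    ≡⟨ %-distribˡ-+ (bit (f zero)) (count (tail f)) 2 ⟩
  (bit (f zero) % 2 + count (tail f) % 2) % 2
    ≡⟨ cong (λ k → (bit (f zero) % 2 + k) % 2) (count-parity (tail f)) ⟩
  (bit (f zero) % 2 + bit (Σ₂ (tail f))) % 2
    ≡⟨ bit-xor (f zero) (Σ₂ (tail f)) ⟩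
  bit (f zero xor Σ₂ (tail f)) ∎
  where
  open ≡-Reasoning
  bit-xor : ∀ a b → (bit a % 2 + bit b) % 2 ≡ bit (a xor b)
  bit-xor false false = refl
  bit-xor false true  = refl
  bit-xor true  false = refl
  bit-xor true  true  = refl

_⊕_ : ∀ {n} → Vec₂ n → Vec₂ n → Vec₂ n
_⊕_ = zipWith _xor_

_⊙_ : ∀ {n} → Bool → Vec₂ n → Vec₂ n
b ⊙ x = map (b ∧_) x

infixl 30 _⊕_
infixr 35 _⊙_

SymmetricMat : ∀ {n} → Mat₂ n → Set
SymmetricMat A = ∀ i j → A i j ≡ A j i

·ᵥ-cong : ∀ {n} (A : Mat₂ n) {x y : Vec₂ n} → x ≐ y → (A ·ᵥ x) ≐ (A ·ᵥ y)
·ᵥ-cong A x≐y i = Σ₂-cong (λ j → cong (A i j ∧_) (x≐y j))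

·ᵥ-⊕ : ∀ {n} (A : Mat₂ n) (x y : Vec₂ n) → (A ·ᵥ (x ⊕ y)) ≐ (A ·ᵥ x) ⊕ (A ·ᵥ y)
·ᵥ-⊕ A x y i = trans (Σ₂-cong (λ j → ∧-distribˡ-xor (A i j) (x j) (y j)))
                     (Σ₂-xor (λ j → A i j ∧ x j) (λ j → A i j ∧ y j))

·ᵥ-⊙ : ∀ {n} (A : Mat₂ n) b (x : Vec₂ n) → (A ·ᵥ (b ⊙ x)) ≐ b ⊙ (A ·ᵥ x)
·ᵥ-⊙ A b x i =
  trans (Σ₂-cong (λ j → x∙yz≈y∙xz (A i j) b (x j))) (Σ₂-∧ˡ b (λ j → A i j ∧ x j))

•-comm : ∀ {n} (x y : Vec₂ n) → x • y ≡ y • x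
•-comm x y = Σ₂-cong (λ i → ∧-comm (x i) (y i))

•-congˡ : ∀ {n} {x x′ : Vec₂ n} (y : Vec₂ n) → x ≐ x′ → x • y ≡ x′ • y
•-congˡ y x≐x′ = Σ₂-cong (λ i → cong (_∧ y i) (x≐x′ i))

•-congʳ : ∀ {n} (x : Vec₂ n) {y y′ : Vec₂ n} → y ≐ y′ → x • y ≡ x • y′
•-congʳ x y≐y′ = Σ₂-cong (λ i → cong (x i ∧_) (y≐y′ i))

unitV-self : ∀ {n} (u : Fin n) → unitV u u ≡ true
unitV-self u = trans (isYes≗does (u ≟ u)) (dec-true (u ≟ u) refl)

unitV-other : ∀ {n} {u j : Fin n} → u ≢ j → unitV u j ≡ false
unitV-other {u = u} {j} u≢j = trans (isYes≗does (u ≟ j)) (dec-false (u ≟ j) u≢j)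

unitV-• : ∀ {n} (u : Fin n) (y : Vec₂ n) → unitV u • y ≡ y u
unitV-• u y = trans (Σ₂-single _ u (λ j u≢j → cong (_∧ y j) (unitV-other u≢j)))
                    (cong (_∧ y u) (unitV-self u))

·ᵥ-adjoint : ∀ {n} (A : Mat₂ n) → SymmetricMat A → (x y : Vec₂ n) →
             (A ·ᵥ x) • y ≡ x • (A ·ᵥ y)
·ᵥ-adjoint A A-sym x y = begin
  Σ₂ (λ i → Σ₂ (λ j → A i j ∧ x j) ∧ y i)
    ≡⟨ Σ₂-cong (λ i → sym (Σ₂-∧ʳ (y i) (λ j → A i j ∧ x j))) ⟩
  Σ₂ (λ i → Σ₂ (λ j → (A i j ∧ x j) ∧ y i))
    ≡⟨ Σ₂-comm (λ i j → (A i j ∧ x j) ∧ y i) ⟩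
  Σ₂ (λ j → Σ₂ (λ i → (A i j ∧ x j) ∧ y i))
    ≡⟨ Σ₂-cong (λ j → Σ₂-cong (λ i → term i j)) ⟩
  Σ₂ (λ j → Σ₂ (λ i → x j ∧ (A j i ∧ y i)))
    ≡⟨ Σ₂-cong (λ j → Σ₂-∧ˡ (x j) (λ i → A j i ∧ y i)) ⟩
  Σ₂ (λ j → x j ∧ Σ₂ (λ i → A j i ∧ y i)) ∎
  where
  open ≡-Reasoning
  term : ∀ i j → (A i j ∧ x j) ∧ y i ≡ x j ∧ (A j i ∧ y i)
  term i j = trans (cong (_∧ y i) (∧-comm (A i j) (x j)))
                   (trans (∧-assoc (x j) (A i j) (y i)) (cong (λ a → x j ∧ (a ∧ y i)) (A-sym i j)))

·ᵥ-quadratic : ∀ {n} (A : Mat₂ n) → SymmetricMat A → (∀ i → A i i ≡ true) → (x : Vec₂ n) →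
               (A ·ᵥ x) • x ≡ Σ₂ x
·ᵥ-quadratic A A-sym A-diag x = begin
  Σ₂ (λ i → Σ₂ (λ j → A i j ∧ x j) ∧ x i)
    ≡⟨ Σ₂-cong (λ i → sym (Σ₂-∧ʳ (x i) (λ j → A i j ∧ x j))) ⟩
  Σ₂ (λ i → Σ₂ (λ j → (A i j ∧ x j) ∧ x i))
    ≡⟨ Σ₂-symmetric-trace (λ i j → (A i j ∧ x j) ∧ x i) term-sym ⟩
  Σ₂ (λ i → (A i i ∧ x i) ∧ x i)
    ≡⟨ Σ₂-cong (λ i → cong (λ a → (a ∧ x i) ∧ x i) (A-diag i)) ⟩
  Σ₂ (λ i → x i ∧ x i)
    ≡⟨ Σ₂-cong (λ i → ∧-idem (x i)) ⟩
  Σ₂ x ∎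
  where
  open ≡-Reasoning
  term-sym : ∀ i j → (A i j ∧ x j) ∧ x i ≡ (A j i ∧ x i) ∧ x j
  term-sym i j = begin
    (A i j ∧ x j) ∧ x i  ≡⟨ ∧-assoc (A i j) (x j) (x i) ⟩
    A i j ∧ (x j ∧ x i)  ≡⟨ cong₂ _∧_ (A-sym i j) (∧-comm (x j) (x i)) ⟩
    A j i ∧ (x i ∧ x j)  ≡⟨ ∧-assoc (A j i) (x i) (x j) ⟨
    (A j i ∧ x i) ∧ x j  ∎

x•oneV : ∀ {n} (x : Vec₂ n) → x • oneV ≡ Σ₂ x
x•oneV x = Σ₂-cong (λ i → ∧-identityʳ (x i))

KernelTrivial : ∀ {n} → Mat₂ n → Set
KernelTrivial {n} A = ∀ (x : Vec₂ n) → (A ·ᵥ x) ≐ zeroV → x ≐ zeroV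

·ᵥ-injective : ∀ {n} (A : Mat₂ n) → KernelTrivial A →
               ∀ {x y} → (A ·ᵥ x) ≐ (A ·ᵥ y) → x ≐ y
·ᵥ-injective A ker-trivial {x} {y} Ax≐Ay j = xor≡false⇒≡ (ker-trivial (x ⊕ y) A[x⊕y]≐0 j)
  where
  A[x⊕y]≐0 : (A ·ᵥ (x ⊕ y)) ≐ zeroV
  A[x⊕y]≐0 i =
    trans (·ᵥ-⊕ A x y i) (trans (cong (_xor (A ·ᵥ y) i) (Ax≐Ay i)) (xor-same ((A ·ᵥ y) i)))

unit-solutions-symmetric : ∀ {n} (A : Mat₂ n) → SymmetricMat A → ∀ {u v p q} →
                           (A ·ᵥ p) ≐ unitV u → (A ·ᵥ q) ≐ unitV v → q u ≡ p v
unit-solutions-symmetric A A-sym {u} {v} {p} {q} Ap≐u Aq≐v = begin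
  q u                 ≡⟨ unitV-• u q ⟨
  unitV u • q         ≡⟨ •-congˡ q Ap≐u ⟨
  (A ·ᵥ p) • q        ≡⟨ ·ᵥ-adjoint A A-sym p q ⟩
  p • (A ·ᵥ q)        ≡⟨ •-comm p (A ·ᵥ q) ⟩
  (A ·ᵥ q) • p        ≡⟨ •-congˡ p Aq≐v ⟩
  unitV v • p         ≡⟨ unitV-• v p ⟩
  p v                 ∎
  where open ≡-Reasoning

unit-solution-diagonal : ∀ {n} (A : Mat₂ n) → SymmetricMat A → (∀ i → A i i ≡ true) →
                         ∀ {u p s} → (A ·ᵥ p) ≐ unitV u → (A ·ᵥ s) ≐ oneV → p u ≡ s u
unit-solution-diagonal A A-sym A-diag {u} {p} {s} Ap≐u As≐1 = begin
  p u                 ≡⟨ unitV-• u p ⟨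
  unitV u • p         ≡⟨ •-congˡ p Ap≐u ⟨
  (A ·ᵥ p) • p        ≡⟨ ·ᵥ-quadratic A A-sym A-diag p ⟩
  Σ₂ p                ≡⟨ x•oneV p ⟨
  p • oneV            ≡⟨ •-congʳ p As≐1 ⟨
  p • (A ·ᵥ s)        ≡⟨ ·ᵥ-adjoint A A-sym p s ⟨
  (A ·ᵥ p) • s        ≡⟨ •-congˡ s Ap≐u ⟩
  unitV u • s         ≡⟨ unitV-• u s ⟩
  s u                 ∎
  where open ≡-Reasoning

countWhere : ∀ {A : Set} → (A → Bool) → List A → ℕ
countWhere q xs = length (filter (T? ∘ q) xs)

countWhere-++ : ∀ {A : Set} (q : A → Bool) (xs ys : List A) →
                countWhere q (xs ++ ys) ≡ countWhere q xs + countWhere q ys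
countWhere-++ q xs ys =
  trans (cong length (filter-++ (T? ∘ q) xs ys)) (length-++ (filter (T? ∘ q) xs))

countWhere-map : ∀ {A B : Set} {q : B → Bool} {p : A → Bool} (f : A → B) →
                 (∀ x → q (f x) ≡ p x) → ∀ xs → countWhere q (List.map f xs) ≡ countWhere p xs
countWhere-map             f qf≗p []       = refl
countWhere-map {q = q} {p} f qf≗p (x ∷ xs) with q (f x) | p x | qf≗p x
... | true  | true  | _ = cong suc (countWhere-map f qf≗p xs)
... | false | false | _ = countWhere-map f qf≗p xs

countWhere-map-++ : ∀ {A B : Set} {q : B → Bool} {p p′ : A → Bool} (f g : A → B) xs →
                    (∀ x → q (f x) ≡ p x) → (∀ x → q (g x) ≡ p′ x) →
                    countWhere q (List.map f xs ++ List.map g xs) ≡ countWhere p xs + countWhere p′ xs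
countWhere-map-++ {q = q} f g xs qf≗p qg≗p′ =
  trans (countWhere-++ q (List.map f xs) (List.map g xs))
        (cong₂ _+_ (countWhere-map f qf≗p xs) (countWhere-map g qg≗p′ xs))

countWhere-witness : ∀ {A : Set} (q : A → Bool) (xs : List A) →
                     1 ≤ countWhere q xs → ∃ λ x → q x ≡ true
countWhere-witness q (x ∷ xs) pos with q x in qx
... | true  = x , qx
... | false = countWhere-witness q xs pos

countWhere-head : ∀ {A : Set} (q : A → Bool) {x : A} (xs : List A) →
                  q x ≡ true → 1 ≤ countWhere q (x ∷ xs)
countWhere-head q {x} xs qx with q x | qx
... | true | refl = s≤s z≤n

-- allVecs is built with a cons local to Defs, so predicates on vectors are only ever
-- compared up to pointwise equality.
RespectsPointwise : ∀ {n} → (Vec₂ n → Bool) → Set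
RespectsPointwise {n} q = ∀ {x y : Vec₂ n} → x ≐ y → q x ≡ q y

countVecs : ∀ n → (Vec₂ n → Bool) → ℕ
countVecs n q = countWhere q (allVecs n)

◂-tail : ∀ {n} {b} (x : Vec₂ (suc n)) → b ≡ x zero → (b ◂ tail x) ≐ x
◂-tail x b≡x₀ zero    = b≡x₀
◂-tail x b≡x₀ (suc i) = refl

respects-◂ : ∀ {n} {q : Vec₂ (suc n) → Bool} b →
             RespectsPointwise q → RespectsPointwise (q ∘ (b ◂_))
respects-◂ b resp x≐y = resp λ { zero → refl ; (suc i) → x≐y i }

countVecs-suc : ∀ n {q : Vec₂ (suc n) → Bool} → RespectsPointwise q →
                countVecs (suc n) q ≡ countVecs n (q ∘ (false ◂_)) + countVecs n (q ∘ (true ◂_))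
countVecs-suc n resp =
  countWhere-map-++ _ _ (allVecs n) (λ _ → resp λ { zero → refl ; (suc i) → refl })
                                    (λ _ → resp λ { zero → refl ; (suc i) → refl })

countVecs-split : ∀ n {q : Vec₂ (suc n) → Bool} → RespectsPointwise q → ∀ b →
                  countVecs (suc n) q ≡ countVecs n (q ∘ (b ◂_)) + countVecs n (q ∘ (not b ◂_))
countVecs-split n resp false = countVecs-suc n resp
countVecs-split n {q} resp true  =
  trans (countVecs-suc n resp) (+-comm (countVecs n (q ∘ (false ◂_))) (countVecs n (q ∘ (true ◂_))))

countVecs-half≤ : ∀ n {q : Vec₂ (suc n) → Bool} → RespectsPointwise q → ∀ b →
                  countVecs n (q ∘ (b ◂_)) ≤ countVecs (suc n) q
countVecs-half≤ n resp b =
  ≤-trans (m≤m+n _ _) (≤-reflexive (sym (countVecs-split n resp b)))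

countVecs-pos : ∀ n {q : Vec₂ n → Bool} → RespectsPointwise q →
                ∀ x → q x ≡ true → 1 ≤ countVecs n q
countVecs-pos zero    {q} resp x qx = countWhere-head q [] (trans (resp (λ ())) qx)
countVecs-pos (suc n) {q} resp x qx =
  ≤-trans (countVecs-pos n (respects-◂ (x zero) resp) (tail x) (trans (resp (◂-tail x refl)) qx))
          (countVecs-half≤ n resp (x zero))

countVecs-two : ∀ n {q : Vec₂ n → Bool} → RespectsPointwise q →
                ∀ {x y} → q x ≡ true → q y ≡ true → ∀ i → x i ≢ y i → 2 ≤ countVecs n q
countVecs-two (suc n) {q} resp {x} {y} qx qy zero x₀≢y₀ =
  subst (2 ≤_) (sym (countVecs-split n resp (x zero)))
    (+-mono-≤ (countVecs-pos n (respects-◂ (x zero) resp) (tail x) (trans (resp (◂-tail x refl)) qx))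
              (countVecs-pos n (respects-◂ (not (x zero)) resp) (tail y)
                 (trans (resp (◂-tail y (sym (¬-not (x₀≢y₀ ∘ sym))))) qy)))
countVecs-two (suc n) {q} resp {x} {y} qx qy (suc i) xᵢ≢yᵢ with x zero Bool.≟ y zero
... | no  x₀≢y₀ = countVecs-two (suc n) resp qx qy zero x₀≢y₀
... | yes x₀≡y₀ =
  ≤-trans (countVecs-two n (respects-◂ (x zero) resp) (trans (resp (◂-tail x refl)) qx)
                         (trans (resp (◂-tail y x₀≡y₀)) qy) i xᵢ≢yᵢ)
          (countVecs-half≤ n resp (x zero))

countVecs-nonzero : ∀ n {q : Vec₂ n → Bool} → RespectsPointwise q → 2 ≤ countVecs n q →
                    ∃ λ x → q x ≡ true × ∃ λ i → x i ≡ true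
countVecs-nonzero zero    {q} resp two =
  contradiction (≤-trans two (length-filter (T? ∘ q) (allVecs 0))) λ { (s≤s ()) }
countVecs-nonzero (suc n) {q} resp two
  with countVecs n (q ∘ (true ◂_)) in ones | subst (2 ≤_) (countVecs-suc n resp) two
... | zero  | two′ =
  let x , qx , i , xᵢ =
        countVecs-nonzero n (respects-◂ false resp) (subst (2 ≤_) (+-identityʳ _) two′)
  in false ◂ x , qx , suc i , xᵢ
... | suc _ | _ =
  let x , qx = countWhere-witness (q ∘ (true ◂_)) (allVecs n) (subst (1 ≤_) (sym ones) (s≤s z≤n))
  in true ◂ x , qx , zero , refl

isZero-◂ : ∀ {m} (x : Vec₂ (suc m)) → isZero x ≡ not (x zero) ∧ isZero (tail x)
isZero-◂ x with x zero
... | true  = refl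
... | false = refl

isZero⇒≐zero : ∀ {m} (x : Vec₂ m) → isZero x ≡ true → x ≐ zeroV
isZero⇒≐zero {suc m} x zx with x zero in x₀ | trans (sym (isZero-◂ x)) zx
... | false | rest = λ { zero → x₀ ; (suc i) → isZero⇒≐zero (tail x) rest i }

≐zero⇒isZero : ∀ {m} (x : Vec₂ m) → x ≐ zeroV → isZero x ≡ true
≐zero⇒isZero {zero}  x x≐0 = refl
≐zero⇒isZero {suc m} x x≐0 =
  trans (isZero-◂ x) (cong₂ (λ a b → not a ∧ b) (x≐0 zero) (≐zero⇒isZero (tail x) (x≐0 ∘ suc)))

isZero-cong : ∀ {m} {x y : Vec₂ m} → x ≐ y → isZero x ≡ isZero y
isZero-cong {zero}          x≐y = refl
isZero-cong {suc m} {x} {y} x≐y =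
  trans (isZero-◂ x)
        (trans (cong₂ (λ a b → not a ∧ b) (x≐y zero) (isZero-cong (x≐y ∘ suc))) (sym (isZero-◂ y)))

inKer : ∀ {n} → Mat₂ n → Vec₂ n → Bool
inKer A x = isZero (A ·ᵥ x)

inKer-respects : ∀ {n} (A : Mat₂ n) → RespectsPointwise (inKer A)
inKer-respects A x≐y = isZero-cong (·ᵥ-cong A x≐y)

·ᵥ-zero : ∀ {n} (A : Mat₂ n) → (A ·ᵥ zeroV) ≐ zeroV
·ᵥ-zero {n} A i = trans (Σ₂-cong (λ j → ∧-zeroʳ (A i j))) (Σ₂-zero {n})

dimKer≡0⇒kernel-trivial : ∀ {n} (A : Mat₂ n) → dimKer A ≡ 0 → KernelTrivial A
dimKer≡0⇒kernel-trivial {n} A dim≡0 x Ax≐0 i with x i in xᵢ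
... | false = refl
... | true  = contradiction (subst (0 <_) dim≡0 (⌊log₂⌋-pos two-kernel-vectors)) (<-irrefl refl)
  where
  two-kernel-vectors : 2 ≤ kerSize A
  two-kernel-vectors =
    countVecs-two n (inKer-respects A) (≐zero⇒isZero _ Ax≐0) (≐zero⇒isZero _ (·ᵥ-zero A))
                  i (not-¬ xᵢ)
  ⌊log₂⌋-pos : ∀ {k} → 2 ≤ k → 0 < ⌊log₂ k ⌋
  ⌊log₂⌋-pos {k} 2≤k = subst (_≤ ⌊log₂ k ⌋) (⌊log₂[2^n]⌋≡n 1) (⌊log₂⌋-mono-≤ 2≤k)

0<dimKer⇒nonzero-kernel : ∀ {n} (A : Mat₂ n) → 0 < dimKer A →
                          ∃ λ x → (A ·ᵥ x) ≐ zeroV × ∃ λ i → x i ≡ true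
0<dimKer⇒nonzero-kernel {n} A pos =
  let x , kx , nz = countVecs-nonzero n (inKer-respects A) (⌊log₂⌋-pos⇒2≤ (kerSize A) pos)
  in x , isZero⇒≐zero _ kx , nz
  where
  ⌊log₂⌋-pos⇒2≤ : ∀ k → 0 < ⌊log₂ k ⌋ → 2 ≤ k
  ⌊log₂⌋-pos⇒2≤ (suc (suc k)) _ = s≤s (s≤s z≤n)

Fin-injective⇒surjective : ∀ {m} (f : Fin m → Fin m) → Injective _≡_ _≡_ f →
                           ∀ y → ∃ λ x → f x ≡ y
Fin-injective⇒surjective {suc m} f f-inj y with any? (λ x → f x Fin.≟ y)
... | yes hit  = hit
... | no  miss = contradiction (injective⇒≤ f′-inj) 1+n≰n
  where
  y≢f : ∀ x → y ≢ f x
  y≢f x y≡fx = miss (x , sym y≡fx)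
  f′ : Fin (suc m) → Fin m
  f′ x = punchOut (y≢f x)
  f′-inj : Injective _≡_ _≡_ f′
  f′-inj {x} {x′} = f-inj ∘ punchOut-injective (y≢f x) (y≢f x′)

finToBool : Fin 2 → Bool
finToBool zero    = false
finToBool (suc _) = true

boolToFin : Bool → Fin 2
boolToFin false = zero
boolToFin true  = suc zero

encode : ∀ {n} → Vec₂ n → Fin (2 ^ n)
encode x = funToFin (boolToFin ∘ x)

decode : ∀ {n} → Fin (2 ^ n) → Vec₂ n
decode {n} k = finToBool ∘ finToFun {n = n} k

encode-injective : ∀ {n} {x y : Vec₂ n} → encode x ≡ encode y → x ≐ y
encode-injective {x = x} {y} ex≡ey i = begin
  x i                                         ≡⟨ finToBool-boolToFin (x i) ⟨
  finToBool (boolToFin (x i))                 ≡⟨ cong finToBool (finToFun-funToFin (boolToFin ∘ x) i) ⟨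
  finToBool (finToFun (encode x) i)           ≡⟨ cong (λ k → finToBool (finToFun k i)) ex≡ey ⟩
  finToBool (finToFun (encode y) i)           ≡⟨ cong finToBool (finToFun-funToFin (boolToFin ∘ y) i) ⟩
  finToBool (boolToFin (y i))                 ≡⟨ finToBool-boolToFin (y i) ⟩
  y i                                         ∎
  where
  open ≡-Reasoning
  finToBool-boolToFin : ∀ b → finToBool (boolToFin b) ≡ b
  finToBool-boolToFin false = refl
  finToBool-boolToFin true  = refl

decode-injective : ∀ {n} {k k′ : Fin (2 ^ n)} → decode {n} k ≐ decode k′ → k ≡ k′
decode-injective {n} {k} {k′} dk≐dk′ = begin
  k                                ≡⟨ funToFin-finToFun {m = n} k ⟨
  funToFin (finToFun {n = n} k)    ≡⟨ funToFin-cong (λ i → finToBool-injective (dk≐dk′ i)) ⟩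
  funToFin (finToFun {n = n} k′)   ≡⟨ funToFin-finToFun {m = n} k′ ⟩
  k′                      ∎
  where
  open ≡-Reasoning
  finToBool-injective : ∀ {a b} → finToBool a ≡ finToBool b → a ≡ b
  finToBool-injective {zero}        {zero}        _ = refl
  finToBool-injective {suc zero}    {suc zero}    _ = refl
  funToFin-cong : ∀ {m} {f g : Fin m → Fin 2} → (∀ i → f i ≡ g i) → funToFin f ≡ funToFin g
  funToFin-cong {zero}  f≗g = refl
  funToFin-cong {suc m} f≗g = cong₂ combine (f≗g zero) (funToFin-cong (f≗g ∘ suc))

·ᵥ-surjective : ∀ {n} (A : Mat₂ n) → KernelTrivial A → ∀ b → ∃ λ p → (A ·ᵥ p) ≐ b
·ᵥ-surjective {n} A ker-trivial b =
  let k , gk≡b = Fin-injective⇒surjective g g-inj (encode b)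
  in decode k , encode-injective gk≡b
  where
  g : Fin (2 ^ n) → Fin (2 ^ n)
  g k = encode (A ·ᵥ decode k)
  g-inj : Injective _≡_ _≡_ g
  g-inj = decode-injective ∘ ·ᵥ-injective A ker-trivial ∘ encode-injective

N-symmetric : ∀ {n} (G : Graph n) → SymmetricMat (N G)
N-symmetric G i j = cong₂ _∨_ (≟-sym i j) (Graph.sym G i j)

N-diagonal : ∀ {n} (G : Graph n) i → N G i i ≡ true
N-diagonal G i = cong (_∨ adj G i i) (unitV-self i)

N-row : ∀ {n} (G : Graph n) (y : Vec₂ n) v → (N G ·ᵥ y) v ≡ y v xor Σ₂ (λ j → adj G v j ∧ y j)
N-row G y v = begin
  Σ₂ (λ j → (unitV v j ∨ adj G v j) ∧ y j)
    ≡⟨ Σ₂-cong (λ j → cong (_∧ y j) (∨-disjoint (unitV v j) (adj G v j) (loop-free j))) ⟩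
  Σ₂ (λ j → (unitV v j xor adj G v j) ∧ y j)
    ≡⟨ Σ₂-cong (λ j → ∧-distribʳ-xor (y j) (unitV v j) (adj G v j)) ⟩
  Σ₂ (λ j → (unitV v j ∧ y j) xor (adj G v j ∧ y j))
    ≡⟨ Σ₂-xor (λ j → unitV v j ∧ y j) (λ j → adj G v j ∧ y j) ⟩
  unitV v • y xor Σ₂ (λ j → adj G v j ∧ y j)
    ≡⟨ cong (_xor Σ₂ (λ j → adj G v j ∧ y j)) (unitV-• v y) ⟩
  y v xor Σ₂ (λ j → adj G v j ∧ y j) ∎
  where
  open ≡-Reasoning
  loop-free : ∀ j → unitV v j ∧ adj G v j ≡ false
  loop-free j with v ≟ j
  ... | yes refl = Graph.irrefl G v
  ... | no  _    = refl

adj⇒≢ : ∀ {n} (G : Graph n) {a b} → adj G a b ≡ true → a ≢ b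
adj⇒≢ G {a} ab refl = not-¬ ab (Graph.irrefl G a)

-- Definitionally the indicator matrix by which removeEdge deletes the edge ab.
edgeMat : ∀ {n} → Fin n → Fin n → Mat₂ n
edgeMat a b i j = (⌊ i ≟ a ⌋ ∧ ⌊ j ≟ b ⌋) ∨ (⌊ i ≟ b ⌋ ∧ ⌊ j ≟ a ⌋)

both-≟ : ∀ {n} {i a j b : Fin n} → ⌊ i ≟ a ⌋ ∧ ⌊ j ≟ b ⌋ ≡ true → i ≡ a × j ≡ b
both-≟ {i = i} {a} {j} {b} hit with i ≟ a | j ≟ b
... | yes i≡a | yes j≡b = i≡a , j≡b

edgeMat-support : ∀ {n} {a b i j : Fin n} → edgeMat a b i j ≡ true →
                  (i ≡ a × j ≡ b) ⊎ (i ≡ b × j ≡ a)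
edgeMat-support {a = a} {b} {i} {j} hit with ⌊ i ≟ a ⌋ ∧ ⌊ j ≟ b ⌋ in first
... | true  = inj₁ (both-≟ first)
... | false = inj₂ (both-≟ hit)

N-removeEdge : ∀ {n} (G : Graph n) {a b} (ab : adj G a b ≡ true) i j →
               N (G -ₑ (a , b , ab)) i j ≡ N G i j xor edgeMat a b i j
N-removeEdge G {a} {b} ab i j = ∨-∧-not (unitV i j) (adj G i j) (edgeMat a b i j) endpoint
  where
  endpoint : edgeMat a b i j ≡ true → unitV i j ≡ false × adj G i j ≡ true
  endpoint hit with edgeMat-support {a = a} {b} {i} {j} hit
  ... | inj₁ (refl , refl) = unitV-other (adj⇒≢ G ab) , ab
  ... | inj₂ (refl , refl) = unitV-other (adj⇒≢ G ab ∘ sym) , trans (Graph.sym G b a) ab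

edgeMat-·ᵥ : ∀ {n} {a b : Fin n} → a ≢ b → (x : Vec₂ n) →
             (edgeMat a b ·ᵥ x) ≐ x b ⊙ unitV a ⊕ x a ⊙ unitV b
edgeMat-·ᵥ {a = a} {b} a≢b x i = begin
  Σ₂ (λ j → edgeMat a b i j ∧ x j)
    ≡⟨ Σ₂-cong (λ j → trans (cong (_∧ x j) (∨-disjoint (row a b j) (row b a j) (disjoint j)))
                            (∧-distribʳ-xor (x j) (row a b j) (row b a j))) ⟩
  Σ₂ (λ j → (row a b j ∧ x j) xor (row b a j ∧ x j))
    ≡⟨ Σ₂-xor (λ j → row a b j ∧ x j) (λ j → row b a j ∧ x j) ⟩
  Σ₂ (λ j → row a b j ∧ x j) xor Σ₂ (λ j → row b a j ∧ x j)
    ≡⟨ cong₂ _xor_ (pick a b) (pick b a) ⟩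
  (x b ∧ unitV a i) xor (x a ∧ unitV b i) ∎
  where
  open ≡-Reasoning
  row : Fin _ → Fin _ → Vec₂ _
  row c d j = ⌊ i ≟ c ⌋ ∧ ⌊ j ≟ d ⌋
  disjoint : ∀ j → row a b j ∧ row b a j ≡ false
  disjoint j with i ≟ a | i ≟ b
  ... | no  _    | _        = refl
  ... | yes _    | no  _    = ∧-zeroʳ ⌊ j ≟ b ⌋
  ... | yes refl | yes refl = contradiction refl a≢b
  pick : ∀ c d → Σ₂ (λ j → row c d j ∧ x j) ≡ x d ∧ unitV c i
  pick c d = begin
    Σ₂ (λ j → (⌊ i ≟ c ⌋ ∧ ⌊ j ≟ d ⌋) ∧ x j)
      ≡⟨ Σ₂-cong (λ j → trans (∧-assoc ⌊ i ≟ c ⌋ ⌊ j ≟ d ⌋ (x j))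
                              (cong (λ δ → ⌊ i ≟ c ⌋ ∧ (δ ∧ x j)) (≟-sym j d))) ⟩
    Σ₂ (λ j → ⌊ i ≟ c ⌋ ∧ (unitV d j ∧ x j))
      ≡⟨ Σ₂-∧ˡ ⌊ i ≟ c ⌋ (λ j → unitV d j ∧ x j) ⟩
    ⌊ i ≟ c ⌋ ∧ (unitV d • x)
      ≡⟨ cong₂ _∧_ (≟-sym i c) (unitV-• d x) ⟩
    unitV c i ∧ x d
      ≡⟨ ∧-comm (unitV c i) (x d) ⟩
    x d ∧ unitV c i ∎

removeEdge-·ᵥ : ∀ {n} (G : Graph n) {a b} (ab : adj G a b ≡ true) (x : Vec₂ n) →
                (N (G -ₑ (a , b , ab)) ·ᵥ x) ≐ (N G ·ᵥ x) ⊕ (x b ⊙ unitV a ⊕ x a ⊙ unitV b)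
removeEdge-·ᵥ G {a} {b} ab x i = begin
  Σ₂ (λ j → N (G -ₑ (a , b , ab)) i j ∧ x j)
    ≡⟨ Σ₂-cong (λ j → trans (cong (_∧ x j) (N-removeEdge G ab i j))
                            (∧-distribʳ-xor (x j) (N G i j) (edgeMat a b i j))) ⟩
  Σ₂ (λ j → (N G i j ∧ x j) xor (edgeMat a b i j ∧ x j))
    ≡⟨ Σ₂-xor (λ j → N G i j ∧ x j) (λ j → edgeMat a b i j ∧ x j) ⟩
  (N G ·ᵥ x) i xor (edgeMat a b ·ᵥ x) i
    ≡⟨ cong ((N G ·ᵥ x) i xor_) (edgeMat-·ᵥ (adj⇒≢ G ab) x i) ⟩
  (N G ·ᵥ x) i xor ((x b ∧ unitV a i) xor (x a ∧ unitV b i)) ∎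
  where open ≡-Reasoning

module ClosedNeighbourhoodInverse {n} (G : Graph n) (ν≡0 : ν G ≡ 0) where

  kernel-trivial : KernelTrivial (N G)
  kernel-trivial = dimKer≡0⇒kernel-trivial (N G) ν≡0

  s : Vec₂ n
  s = proj₁ (·ᵥ-surjective (N G) kernel-trivial oneV)

  s-odd : OddDominating G s
  s-odd = proj₂ (·ᵥ-surjective (N G) kernel-trivial oneV)

  col : Fin n → Vec₂ n
  col u = proj₁ (·ᵥ-surjective (N G) kernel-trivial (unitV u))

  N·col : ∀ u → (N G ·ᵥ col u) ≐ unitV u
  N·col u = proj₂ (·ᵥ-surjective (N G) kernel-trivial (unitV u))

  col-sym : ∀ u v → col u v ≡ col v u
  col-sym u v = unit-solutions-symmetric (N G) (N-symmetric G) (N·col v) (N·col u)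

  col-diag : ∀ u → col u u ≡ s u
  col-diag u = unit-solution-diagonal (N G) (N-symmetric G) (N-diagonal G) (N·col u) s-odd

  critical-edge : ∀ {a b} (ab : adj G a b ≡ true) → 0 < ν (G -ₑ (a , b , ab)) →
                  col a b ≡ not (s a ∧ s b)
  critical-edge {a} {b} ab pos = 2×2-singular at-a at-b nonzero
    where
    G′ = G -ₑ (a , b , ab)
    kernel-vector = 0<dimKer⇒nonzero-kernel (N G′) pos
    x = proj₁ kernel-vector
    z = x b ⊙ col a ⊕ x a ⊙ col b
    N·x : (N G ·ᵥ x) ≐ x b ⊙ unitV a ⊕ x a ⊙ unitV b
    N·x i = xor≡false⇒≡ (trans (sym (removeEdge-·ᵥ G ab x i)) (proj₁ (proj₂ kernel-vector) i))
    N·z : (N G ·ᵥ z) ≐ x b ⊙ unitV a ⊕ x a ⊙ unitV b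
    N·z i = trans (·ᵥ-⊕ (N G) (x b ⊙ col a) (x a ⊙ col b) i)
                  (cong₂ _xor_ (trans (·ᵥ-⊙ (N G) (x b) (col a) i) (cong (x b ∧_) (N·col a i)))
                               (trans (·ᵥ-⊙ (N G) (x a) (col b) i) (cong (x a ∧_) (N·col b i))))
    x≐z : x ≐ z
    x≐z = ·ᵥ-injective (N G) kernel-trivial (λ i → trans (N·x i) (sym (N·z i)))
    at-a : x a ≡ (x b ∧ s a) xor (x a ∧ col a b)
    at-a = trans (x≐z a) (cong₂ (λ p q → (x b ∧ p) xor (x a ∧ q)) (col-diag a) (col-sym b a))
    at-b : x b ≡ (x b ∧ col a b) xor (x a ∧ s b)
    at-b = trans (x≐z b) (cong (λ p → (x b ∧ col a b) xor (x a ∧ p)) (col-diag b))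
    nonzero : x a ∨ x b ≡ true
    nonzero with x a in xa | x b in xb
    ... | true  | _     = refl
    ... | false | true  = refl
    ... | false | false =
      contradiction (trans (x≐z i₀) (cong₂ (λ p q → (p ∧ col a i₀) xor (q ∧ col b i₀)) xb xa))
                    (not-¬ xᵢ₀)
      where
      i₀ = proj₁ (proj₂ (proj₂ kernel-vector))
      xᵢ₀ = proj₂ (proj₂ (proj₂ kernel-vector))

  degree-parity : ∀ v → (∀ {j} → adj G v j ≡ true → col v j ≡ not (s v ∧ s j)) →
                  degree G v % 2 ≡ bit (not (s v))
  degree-parity v neighbour-col =
    trans (count-parity (adj G v)) (cong bit (degree-equation unit-row odd-row))
    where
    degree-equation : ∀ {s d t} → s xor (d xor (t ∧ s)) ≡ true → s xor t ≡ true → d ≡ not s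
    degree-equation {false} {true}          _  refl = refl
    degree-equation {false} {false}         () refl
    degree-equation {true}  {false} {false} _  _    = refl
    degree-equation {true}  {true}  {false} () _
    degree-equation {true}  {t = true}      _  ()
    T = Σ₂ (λ j → adj G v j ∧ s j)
    odd-row : s v xor T ≡ true
    odd-row = trans (sym (N-row G s v)) (s-odd v)
    term : ∀ j → adj G v j ∧ col v j ≡ adj G v j xor ((adj G v j ∧ s j) ∧ s v)
    term j with adj G v j in vj
    ... | false = refl
    ... | true  = trans (neighbour-col vj) (cong not (∧-comm (s v) (s j)))
    neighbour-sum : Σ₂ (λ j → adj G v j ∧ col v j) ≡ Σ₂ (adj G v) xor (T ∧ s v)
    neighbour-sum = trans (Σ₂-cong term)
      (trans (Σ₂-xor (adj G v) (λ j → (adj G v j ∧ s j) ∧ s v))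
             (cong (Σ₂ (adj G v) xor_) (Σ₂-∧ʳ (s v) (λ j → adj G v j ∧ s j))))
    unit-row : s v xor (Σ₂ (adj G v) xor (T ∧ s v)) ≡ true
    unit-row = trans (sym (cong₂ _xor_ (col-diag v) neighbour-sum))
                     (trans (sym (N-row G (col v) v)) (trans (N·col v v) (unitV-self v)))

mainTheorem4 : ∀ {n : ℕ} (G : Graph n) → ν G ≡ 0 → (∀ (e : Edge G) → ν G < ν (G -ₑ e)) →
    (∀ (v : Fin n) → AlwaysActivated G v → degree G v % 2 ≡ 0) ×
    (∀ (v : Fin n) → NeverActivated G v → degree G v % 2 ≡ 1)
mainTheorem4 G ν≡0 critical =
    (λ v (_ , always) → parity-from v (always s s-odd))
  , (λ v (_ , never)  → parity-from v (never s s-odd))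
  where
  open ClosedNeighbourhoodInverse G ν≡0
  parity-from : ∀ v {b} → unitV v • s ≡ b → degree G v % 2 ≡ bit (not b)
  parity-from v v•s≡b =
    trans (degree-parity v neighbour-col) (cong (bit ∘ not) (trans (sym (unitV-• v s)) v•s≡b))
    where
    neighbour-col : ∀ {j} → adj G v j ≡ true → col v j ≡ not (s v ∧ s j)
    neighbour-col {j} vj =
      critical-edge vj (subst (_< ν (G -ₑ (v , j , vj))) ν≡0 (critical (v , j , vj)))
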